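{- Let $\mathbf{t}=t_0t_1t_2\cdots$ be the Thue--Morse word and $p_{\mathbf t}$ its periodicity function. Then for every integer $i\ge 0$: \begin{itemize} \item if $i$ is even, then $p_{\mathbf t}(i)\in\{1,2\}$; \item if $i$ is odd and $t\ge 0$ is the integer with $2^t\le i<2^{t+1}$, then $p_{\mathbf t}(i)=3\cdot 2^t$. \end{itemize}
   Context: The Thue--Morse word $\mathbf t=t_0t_1t_2\cdots$ over $\{0,1\}$ is defined by $t_i=0$ if the number of $1$'s in the binary representation of $i$ is even, and $t_i=1$ otherwise. For an infinite word $\mathbf w=w_0w_1w_2\cdots$, the periodicity function $p_{\mathbf w}(i)$ is the length of the shortest nonempty prefix $u$ of $w_iw_{i+1}w_{i+2}\cdots$ such that either $u$ is a suffix of $w_0\cdots w_{i-1}$ or $w_0\cdots w_{i-1}$ is a suffix of $u$ (for $i=0$, $w_0\cdots w_{i-1}$ is the empty word); if no such $u$ exists, $p_{\mathbf w}(i)=\infty$ (this does not occur for recurrent words such as $\mathbf t$). -}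

module Defs where

open import Data.Nat using (ℕ; zero; suc; _+_; _*_; _^_; _≤_; _<_; _%_; _/_)
open import Data.Bool using (Bool; true; false)
open import Data.List using (List; applyUpTo)
open import Data.Product using (_×_)
open import Data.Sum using (_⊎_)
open import Relation.Binary.PropositionalEquality using (_≡_)
open import Relation.Nullary using (¬_)
open import Data.List.Relation.Binary.Suffix.Heterogeneous using (Suffix)

Word : Set → Set
Word A = ℕ → A

-- Number of 1's in the binary representation of n, computed with fuel
-- (fuel n suffices, since n / 2 < n for n > 0).
onesAux : ℕ → ℕ → ℕ
onesAux zero    n = 0
onesAux (suc f) n = n % 2 + onesAux f (n / 2)

ones : ℕ → ℕ
ones n = onesAux n n

thueMorse : Word ℕ
thueMorse i = ones i % 2

prefixW : {A : Set} → Word A → ℕ → List A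
prefixW w i = applyUpTo w i

factorW : {A : Set} → Word A → ℕ → ℕ → List A
factorW w i ℓ = applyUpTo (λ k → w (i + k)) ℓ

Candidate : {A : Set} → Word A → ℕ → ℕ → Set
Candidate w i ℓ =
  1 ≤ ℓ × (Suffix _≡_ (factorW w i ℓ) (prefixW w i)
           ⊎ Suffix _≡_ (prefixW w i) (factorW w i ℓ))

PeriodicityIs : {A : Set} → Word A → ℕ → ℕ → Set
PeriodicityIs w i n = Candidate w i n × (∀ m → m < n → ¬ Candidate w i m)

-- Thue–Morse satisfies t(2n) = t(n) and t(1+2n) ≠ t(n). The candidate condition defining the
-- periodicity function amounts to a letter-wise local period p at i. At an even position the shift
-- 1 or 2 works, because t never has three equal consecutive letters. At an odd position i with
-- 2^e ≤ i < 2^(e+1) the shift 3·2^e works, since t has period 3·2^e on its prefix of length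
-- 2^(e+1). Conversely, no odd p is a local period at an odd i ≥ 3, and an even local period 2p at
-- i = 1 + 2k restricts to the local period p at whichever of k, k + 1 is odd; induction on e then
-- bounds every local period at i below by 3·2^e.

module Submission where

open import Defs
open import Data.Nat using (ℕ; zero; suc; _+_; _*_; _^_; _∸_; _%_; _/_; _≤_; _<_; z≤n; s≤s; z<s; s<s; _≟_)
open import Data.Nat.Properties
open import Data.Nat.DivMod using (m/n<m; m*n/n≡m; /-congˡ; /-monoˡ-≤; +-distrib-/-∣ʳ; %-remove-+ʳ; m%n<n)
open import Data.Nat.Divisibility using (m∣m*n; n∣m⇒m%n≡0)
open import Data.Nat.Tactic.RingSolver using (solve)
open import Algebra.Properties.CommutativeSemigroup +-commutativeSemigroup using (xy∙z≈x∙zy)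
open import Algebra.Properties.CommutativeSemigroup *-commutativeSemigroup using (x∙yz≈y∙xz)
open import Data.List using ([]; _∷_; _++_; applyUpTo; length)
open import Data.List.Properties using (length-applyUpTo; ∷-injectiveˡ; ∷-injectiveʳ)
open import Data.List.Relation.Binary.Pointwise using (Pointwise-≡⇒≡; ≡⇒Pointwise-≡)
open import Data.List.Relation.Binary.Suffix.Heterogeneous using (Suffix; here; _++ˢ_)
open import Data.List.Relation.Binary.Suffix.Heterogeneous.Properties using (length-mono; ++⁻)
open import Data.Product using (_×_; _,_; ∃)
open import Data.Sum using (_⊎_; inj₁; inj₂)
open import Function using (_∘_)
open import Relation.Nullary using (¬_; Dec; yes; no; contradiction)
open import Relation.Binary.PropositionalEquality

m+k≡n⇒m≤n : ∀ {m n} k → m + k ≡ n → m ≤ n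
m+k≡n⇒m≤n {m} k eq = subst (m ≤_) eq (m≤m+n m k)

module _ {A : Set} where

  applyUpTo-++ : ∀ (f : ℕ → A) m n → applyUpTo f (m + n) ≡ applyUpTo f m ++ applyUpTo (f ∘ (m +_)) n
  applyUpTo-++ f zero    n = refl
  applyUpTo-++ f (suc m) n = cong (f 0 ∷_) (applyUpTo-++ (f ∘ suc) m n)

  applyUpTo-cong : ∀ (f g : ℕ → A) n → (∀ {x} → x < n → f x ≡ g x) → applyUpTo f n ≡ applyUpTo g n
  applyUpTo-cong f g zero    f≗g = refl
  applyUpTo-cong f g (suc n) f≗g =
    cong₂ _∷_ (f≗g z<s) (applyUpTo-cong (f ∘ suc) (g ∘ suc) n (f≗g ∘ s<s))

  applyUpTo-injective : ∀ (f g : ℕ → A) n → applyUpTo f n ≡ applyUpTo g n →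
                        ∀ {x} → x < n → f x ≡ g x
  applyUpTo-injective f g (suc n) eq {zero}  _         = ∷-injectiveˡ eq
  applyUpTo-injective f g (suc n) eq {suc x} (s<s x<n) =
    applyUpTo-injective (f ∘ suc) (g ∘ suc) n (∷-injectiveʳ eq) x<n

  suffix-applyUpTo⁺ : ∀ (f g : ℕ → A) n d → (∀ {x} → x < n → f x ≡ g (x + d)) →
                      Suffix _≡_ (applyUpTo f n) (applyUpTo g (n + d))
  suffix-applyUpTo⁺ f g n d f≗g rewrite +-comm n d | applyUpTo-++ g d n =
    applyUpTo g d ++ˢ here (≡⇒Pointwise-≡ (applyUpTo-cong f (g ∘ (d +_)) n λ {x} x<n →
      trans (f≗g x<n) (cong g (+-comm x d))))

  suffix-applyUpTo⁻ : ∀ (f g : ℕ → A) n d → Suffix _≡_ (applyUpTo f n) (applyUpTo g (n + d)) →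
                      ∀ {x} → x < n → f x ≡ g (x + d)
  suffix-applyUpTo⁻ f g n d suffix {x} x<n rewrite +-comm n d | applyUpTo-++ g d n =
    trans (applyUpTo-injective f (g ∘ (d +_)) n (Pointwise-≡⇒≡ (++⁻ {as = []} equal-lengths suffix)) x<n)
          (cong g (+-comm d x))
    where
    equal-lengths : length (applyUpTo f n) ≡ length (applyUpTo (g ∘ (d +_)) n)
    equal-lengths = trans (length-applyUpTo f n) (sym (length-applyUpTo (g ∘ (d +_)) n))

  suffix-applyUpTo⇒≤ : ∀ {f g : ℕ → A} {n m} → Suffix _≡_ (applyUpTo f n) (applyUpTo g m) → n ≤ m
  suffix-applyUpTo⇒≤ {f} {g} {n} {m} suffix =
    subst₂ _≤_ (length-applyUpTo f n) (length-applyUpTo g m) (length-mono suffix)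

-- Overlap read letter by letter: the two words compared there overlap exactly at the j < i
-- with i ≤ p + j.
LocalPeriod : {A : Set} → Word A → ℕ → ℕ → Set
LocalPeriod w i p = ∀ j → j < i → i ≤ p + j → w j ≡ w (p + j)

Overlap : {A : Set} → Word A → ℕ → ℕ → Set
Overlap w i p = Suffix _≡_ (factorW w i p) (prefixW w i) ⊎ Suffix _≡_ (prefixW w i) (factorW w i p)

module _ {A : Set} (w : Word A) where

  window⇒localPeriod : ∀ p d → (∀ {x} → x < p → w (x + d) ≡ w (p + (x + d))) → LocalPeriod w (p + d) p
  window⇒localPeriod p d agree j j<p+d p+d≤p+j with j ∸ d | m∸n+n≡m (+-cancelˡ-≤ p d j p+d≤p+j)
  ... | x | refl = agree (+-cancelʳ-< d x p j<p+d)

  localPeriod⇒window : ∀ p d → LocalPeriod w (p + d) p → ∀ {x} → x < p → w (x + d) ≡ w (p + (x + d))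
  localPeriod⇒window p d period {x} x<p = period (x + d) (+-monoˡ-< d x<p) (+-monoʳ-≤ p (m≤n+m d x))

  factorSuffix⇒localPeriod : ∀ {i p} → Suffix _≡_ (factorW w i p) (prefixW w i) → LocalPeriod w i p
  factorSuffix⇒localPeriod {p = p} suffix with m≤n⇒∃[o]m+o≡n (suffix-applyUpTo⇒≤ suffix)
  ... | d , refl = window⇒localPeriod p d λ {x} x<p →
    trans (sym (suffix-applyUpTo⁻ _ w p d suffix x<p)) (cong w (xy∙z≈x∙zy p d x))

  localPeriod⇒factorSuffix : ∀ {i p} → p ≤ i → LocalPeriod w i p →
                             Suffix _≡_ (factorW w i p) (prefixW w i)
  localPeriod⇒factorSuffix {p = p} p≤i period with m≤n⇒∃[o]m+o≡n p≤i
  ... | d , refl = suffix-applyUpTo⁺ _ w p d λ {x} x<p →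
    trans (cong w (xy∙z≈x∙zy p d x)) (sym (localPeriod⇒window p d period x<p))

  prefixSuffix⇒localPeriod : ∀ {i p} → Suffix _≡_ (prefixW w i) (factorW w i p) → LocalPeriod w i p
  prefixSuffix⇒localPeriod {i} suffix with m≤n⇒∃[o]m+o≡n (suffix-applyUpTo⇒≤ suffix)
  ... | d , refl = λ j j<i _ →
    trans (suffix-applyUpTo⁻ w _ i d suffix j<i) (cong w (sym (xy∙z≈x∙zy i d j)))

  localPeriod⇒prefixSuffix : ∀ {i p} → i ≤ p → LocalPeriod w i p →
                             Suffix _≡_ (prefixW w i) (factorW w i p)
  localPeriod⇒prefixSuffix {i} i≤p period with m≤n⇒∃[o]m+o≡n i≤p
  ... | d , refl = suffix-applyUpTo⁺ w _ i d λ {x} x<i →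
    trans (period x x<i (≤-trans (m≤m+n i d) (m≤m+n (i + d) x))) (cong w (xy∙z≈x∙zy i d x))

  overlap⇒localPeriod : ∀ {i p} → Overlap w i p → LocalPeriod w i p
  overlap⇒localPeriod (inj₁ suffix) = factorSuffix⇒localPeriod suffix
  overlap⇒localPeriod (inj₂ suffix) = prefixSuffix⇒localPeriod suffix

  localPeriod⇒overlap : ∀ {i p} → LocalPeriod w i p → Overlap w i p
  localPeriod⇒overlap {i} {p} period with ≤-total p i
  ... | inj₁ p≤i = inj₁ (localPeriod⇒factorSuffix p≤i period)
  ... | inj₂ i≤p = inj₂ (localPeriod⇒prefixSuffix i≤p period)

  periodicityIs : ∀ {i p} → 0 < p → LocalPeriod w i p →
                  (∀ m → 0 < m → m < p → ¬ LocalPeriod w i m) → PeriodicityIs w i p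
  periodicityIs 0<p period noShorter =
    (0<p , localPeriod⇒overlap period) ,
    λ { m m<p (m>0 , overlaps) → noShorter m m>0 m<p (overlap⇒localPeriod overlaps) }

  periodicityIs-1 : ∀ {i} → LocalPeriod w i 1 → PeriodicityIs w i 1
  periodicityIs-1 period = periodicityIs z<s period λ m 0<m m<1 _ → <⇒≱ m<1 0<m

bit-≢-≢ : ∀ {x y z} → x < 2 → y < 2 → z < 2 → x ≢ y → x ≢ z → y ≡ z
bit-≢-≢ z<s       z<s       _         x≢y _   = contradiction refl x≢y
bit-≢-≢ (s<s z<s) (s<s z<s) _         x≢y _   = contradiction refl x≢y
bit-≢-≢ z<s       _         z<s       _   x≢z = contradiction refl x≢z
bit-≢-≢ (s<s z<s) _         (s<s z<s) _   x≢z = contradiction refl x≢z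
bit-≢-≢ z<s       (s<s z<s) (s<s z<s) _   _   = refl
bit-≢-≢ (s<s z<s) z<s       z<s       _   _   = refl

[1+m]%2≢m%2 : ∀ m → suc m % 2 ≢ m % 2
[1+m]%2≢m%2 zero          ()
[1+m]%2≢m%2 (suc zero)    ()
[1+m]%2≢m%2 (suc (suc m)) = [1+m]%2≢m%2 m

[2n]/2≡n : ∀ n → 2 * n / 2 ≡ n
[2n]/2≡n n = trans (/-congˡ (*-comm 2 n)) (m*n/n≡m n 2)

[1+2n]/2≡n : ∀ n → (1 + 2 * n) / 2 ≡ n
[1+2n]/2≡n n = trans (+-distrib-/-∣ʳ 1 (m∣m*n {2} n)) ([2n]/2≡n n)

n≤1+k⇒n/2≤k : ∀ {n k} → n ≤ suc k → n / 2 ≤ k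
n≤1+k⇒n/2≤k {zero}  _     = z≤n
n≤1+k⇒n/2≤k {suc n} n≤1+k = ≤-pred (<-≤-trans (m/n<m (suc n) 2 (s<s z<s)) n≤1+k)

onesAux-fuel-irrelevant : ∀ f g n → n ≤ f → n ≤ g → onesAux f n ≡ onesAux g n
onesAux-fuel-irrelevant zero    zero    _       _   _   = refl
onesAux-fuel-irrelevant zero    (suc g) zero    _   _   = onesAux-fuel-irrelevant zero g zero z≤n z≤n
onesAux-fuel-irrelevant (suc f) zero    zero    _   _   = onesAux-fuel-irrelevant f zero zero z≤n z≤n
onesAux-fuel-irrelevant (suc f) (suc g) n       n≤f n≤g =
  cong (n % 2 +_) (onesAux-fuel-irrelevant f g (n / 2) (n≤1+k⇒n/2≤k n≤f) (n≤1+k⇒n/2≤k n≤g))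

ones-unfold : ∀ n → 0 < n → ones n ≡ n % 2 + ones (n / 2)
ones-unfold (suc n) _ =
  cong (suc n % 2 +_) (onesAux-fuel-irrelevant n (suc n / 2) (suc n / 2) (n≤1+k⇒n/2≤k ≤-refl) ≤-refl)

ones[2n]≡ones[n] : ∀ n → ones (2 * n) ≡ ones n
ones[2n]≡ones[n] zero      = refl
ones[2n]≡ones[n] n@(suc _) = begin
  ones (2 * n)                  ≡⟨ ones-unfold (2 * n) z<s ⟩
  2 * n % 2 + ones (2 * n / 2)  ≡⟨ cong₂ _+_ (n∣m⇒m%n≡0 (2 * n) 2 (m∣m*n {2} n))
                                              (cong ones ([2n]/2≡n n)) ⟩
  ones n                        ∎
  where open ≡-Reasoning

ones[1+2n]≡1+ones[n] : ∀ n → ones (1 + 2 * n) ≡ 1 + ones n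
ones[1+2n]≡1+ones[n] n = begin
  ones (1 + 2 * n)                          ≡⟨ ones-unfold (1 + 2 * n) z<s ⟩
  (1 + 2 * n) % 2 + ones ((1 + 2 * n) / 2)  ≡⟨ cong₂ _+_ (%-remove-+ʳ 1 (m∣m*n {2} n))
                                                          (cong ones ([1+2n]/2≡n n)) ⟩
  1 + ones n                                ∎
  where open ≡-Reasoning

tm : ℕ → ℕ
tm = thueMorse

tm<2 : ∀ n → tm n < 2
tm<2 n = m%n<n (ones n) 2

tm[2n]≡tm[n] : ∀ n → tm (2 * n) ≡ tm n
tm[2n]≡tm[n] n = cong (_% 2) (ones[2n]≡ones[n] n)

tm[1+2n]≢tm[n] : ∀ n → tm (1 + 2 * n) ≢ tm n
tm[1+2n]≢tm[n] n rewrite ones[1+2n]≡1+ones[n] n = [1+m]%2≢m%2 (ones n)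

tm[1+2n]-cong : ∀ m n → tm m ≡ tm n → tm (1 + 2 * m) ≡ tm (1 + 2 * n)
tm[1+2n]-cong m n eq = bit-≢-≢ (tm<2 m) (tm<2 (1 + 2 * m)) (tm<2 (1 + 2 * n))
  (tm[1+2n]≢tm[n] m ∘ sym) (λ e → tm[1+2n]≢tm[n] n (trans (sym e) eq))

tm[1+2n]-injective : ∀ m n → tm (1 + 2 * m) ≡ tm (1 + 2 * n) → tm m ≡ tm n
tm[1+2n]-injective m n eq = bit-≢-≢ (tm<2 (1 + 2 * m)) (tm<2 m) (tm<2 n)
  (tm[1+2n]≢tm[n] m) (λ e → tm[1+2n]≢tm[n] n (trans (sym eq) e))

tm[2+2n]≡tm[1+n] : ∀ n → tm (2 + 2 * n) ≡ tm (1 + n)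
tm[2+2n]≡tm[1+n] n = trans (cong tm (sym (*-suc 2 n))) (tm[2n]≡tm[n] (suc n))

tm[2n]≢tm[1+2n] : ∀ n → tm (2 * n) ≢ tm (1 + 2 * n)
tm[2n]≢tm[1+2n] n eq = tm[1+2n]≢tm[n] n (trans (sym eq) (tm[2n]≡tm[n] n))

tm[1+2n]≢tm[2+2n]⇒tm[n]≡tm[1+n] : ∀ n → tm (1 + 2 * n) ≢ tm (2 + 2 * n) → tm n ≡ tm (1 + n)
tm[1+2n]≢tm[2+2n]⇒tm[n]≡tm[1+n] n neq = bit-≢-≢ (tm<2 (1 + 2 * n)) (tm<2 n) (tm<2 (1 + n))
  (tm[1+2n]≢tm[n] n) (λ e → neq (trans e (sym (tm[2+2n]≡tm[1+n] n))))

data Parity : ℕ → Set where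
  even : ∀ n → Parity (2 * n)
  odd  : ∀ n → Parity (1 + 2 * n)

parity : ∀ n → Parity n
parity zero = even 0
parity (suc n) with parity n
... | even m = odd m
... | odd m  = subst Parity (*-suc 2 m) (even (suc m))

tm[n]≡tm[1+n]⇒tm[1+n]≢tm[2+n] : ∀ n → tm n ≡ tm (1 + n) → tm (1 + n) ≢ tm (2 + n)
tm[n]≡tm[1+n]⇒tm[1+n]≢tm[2+n] n with parity n
... | even m = λ eq _ → tm[2n]≢tm[1+2n] m eq
... | odd m  = λ _ eq → tm[2n]≢tm[1+2n] (suc m) (subst (λ k → tm k ≡ tm (suc k)) (sym (*-suc 2 m)) eq)

2*[3*2^k+z]≡3*2^[1+k]+2*z : ∀ k z → 2 * (3 * 2 ^ k + z) ≡ 3 * 2 ^ suc k + 2 * z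
2*[3*2^k+z]≡3*2^[1+k]+2*z k z = trans (*-distribˡ-+ 2 (3 * 2 ^ k) z) (cong (_+ 2 * z) (x∙yz≈y∙xz 2 3 (2 ^ k)))

tm-period : ∀ k {y} → y < 2 * 2 ^ k → tm y ≡ tm (3 * 2 ^ k + y)
tm-period zero    {0}           _ = refl
tm-period zero    {1}           _ = refl
tm-period zero    {suc (suc y)} (s<s (s<s ()))
tm-period (suc k) {y} y<4P with parity y
... | even z = begin
  tm (2 * z)                   ≡⟨ tm[2n]≡tm[n] z ⟩
  tm z                         ≡⟨ tm-period k (*-cancelˡ-< 2 z (2 * 2 ^ k) y<4P) ⟩
  tm (3 * 2 ^ k + z)           ≡⟨ tm[2n]≡tm[n] (3 * 2 ^ k + z) ⟨
  tm (2 * (3 * 2 ^ k + z))     ≡⟨ cong tm (2*[3*2^k+z]≡3*2^[1+k]+2*z k z) ⟩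
  tm (3 * 2 ^ suc k + 2 * z)   ∎
  where open ≡-Reasoning
... | odd z = begin
  tm (1 + 2 * z)                   ≡⟨ tm[1+2n]-cong z (3 * 2 ^ k + z) (tm-period k z<2P) ⟩
  tm (1 + 2 * (3 * 2 ^ k + z))     ≡⟨ cong (tm ∘ suc) (2*[3*2^k+z]≡3*2^[1+k]+2*z k z) ⟩
  tm (1 + (3 * 2 ^ suc k + 2 * z)) ≡⟨ cong tm (+-suc (3 * 2 ^ suc k) (2 * z)) ⟨
  tm (3 * 2 ^ suc k + (1 + 2 * z)) ∎
  where
  open ≡-Reasoning
  z<2P : z < 2 * 2 ^ k
  z<2P = *-cancelˡ-< 2 z (2 * 2 ^ k) (<-trans (n<1+n (2 * z)) y<4P)

localPeriod-halves : ∀ k p → LocalPeriod tm (1 + 2 * k) (2 * p) → LocalPeriod tm k p × LocalPeriod tm (1 + k) p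
localPeriod-halves k p period = atOdd , atEven
  where
  atOdd : LocalPeriod tm k p
  atOdd j j<k k≤p+j = tm[1+2n]-injective j (p + j) (trans
    (period (1 + 2 * j) (s<s (*-monoʳ-< 2 j<k))
                        (subst (1 + 2 * k ≤_) shift (s≤s (*-monoʳ-≤ 2 k≤p+j))))
    (cong tm (sym shift)))
    where
    shift : 1 + 2 * (p + j) ≡ 2 * p + (1 + 2 * j)
    shift = solve (p ∷ j ∷ [])
  atEven : LocalPeriod tm (1 + k) p
  atEven j (s≤s j≤k) 1+k≤p+j = begin
    tm j                ≡⟨ tm[2n]≡tm[n] j ⟨
    tm (2 * j)          ≡⟨ period (2 * j) (s≤s (*-monoʳ-≤ 2 j≤k)) bound ⟩
    tm (2 * p + 2 * j)  ≡⟨ cong tm (*-distribˡ-+ 2 p j) ⟨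
    tm (2 * (p + j))    ≡⟨ tm[2n]≡tm[n] (p + j) ⟩
    tm (p + j)          ∎
    where
    open ≡-Reasoning
    bound : 1 + 2 * k ≤ 2 * p + 2 * j
    bound = ≤-trans (n≤1+n _) (subst₂ _≤_ (*-suc 2 k) (*-distribˡ-+ 2 p j) (*-monoʳ-≤ 2 1+k≤p+j))

localPeriod-halve : ∀ k p → LocalPeriod tm (1 + 2 * k) (2 * p) →
                    ∃ λ b → k ≤ 1 + 2 * b × LocalPeriod tm (1 + 2 * b) p
localPeriod-halve k p period with parity k | localPeriod-halves k p period
... | even b | _    , atSuc = b , n≤1+n _ , atSuc
... | odd b  | atK  , _     = b , ≤-refl  , atK

¬localPeriod1-atOdd : ∀ k → ¬ LocalPeriod tm (1 + 2 * k) 1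
¬localPeriod1-atOdd k period = tm[2n]≢tm[1+2n] k (period (2 * k) ≤-refl ≤-refl)

-- An odd shift exchanges aligned pairs (2b, 1+2b), whose letters always differ, with misaligned
-- pairs (1+2b, 2+2b); a misaligned pair with differing letters forces tm b ≡ tm (1 + b).
oddLocalPeriod-oddPair : ∀ {i} c a → LocalPeriod tm i (1 + 2 * c) →
                         2 + 2 * a < i → i ≤ 1 + 2 * c + (1 + 2 * a) → tm a ≡ tm (1 + a)
oddLocalPeriod-oddPair {i} c a period 2+2a<i i≤ =
  tm[1+2n]≢tm[2+2n]⇒tm[n]≡tm[1+n] a λ eq → tm[2n]≢tm[1+2n] (suc (a + c)) (begin
    tm (2 * suc (a + c))          ≡⟨ cong tm shift ⟨
    tm (1 + 2 * c + (1 + 2 * a))  ≡⟨ period (1 + 2 * a) (<-trans (n<1+n _) 2+2a<i) i≤ ⟨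
    tm (1 + 2 * a)                ≡⟨ eq ⟩
    tm (2 + 2 * a)                ≡⟨ period (2 + 2 * a) 2+2a<i (≤-trans i≤ (+-monoʳ-≤ (1 + 2 * c) (n≤1+n _))) ⟩
    tm (1 + 2 * c + (2 + 2 * a))  ≡⟨ cong tm shift′ ⟩
    tm (1 + 2 * suc (a + c))      ∎)
  where
  open ≡-Reasoning
  shift : 1 + 2 * c + (1 + 2 * a) ≡ 2 * suc (a + c)
  shift = solve (a ∷ c ∷ [])
  shift′ : 1 + 2 * c + (2 + 2 * a) ≡ 1 + 2 * suc (a + c)
  shift′ = solve (a ∷ c ∷ [])

oddLocalPeriod-evenPair : ∀ {i} c a → LocalPeriod tm i (1 + 2 * c) →
                          1 + 2 * a < i → i ≤ 1 + 2 * c + 2 * a → tm (a + c) ≡ tm (1 + (a + c))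
oddLocalPeriod-evenPair {i} c a period 1+2a<i i≤ =
  tm[1+2n]≢tm[2+2n]⇒tm[n]≡tm[1+n] (a + c) λ eq → tm[2n]≢tm[1+2n] a (begin
    tm (2 * a)                    ≡⟨ period (2 * a) (<-trans (n<1+n _) 1+2a<i) i≤ ⟩
    tm (1 + 2 * c + 2 * a)        ≡⟨ cong tm shift ⟩
    tm (1 + 2 * (a + c))          ≡⟨ eq ⟩
    tm (2 + 2 * (a + c))          ≡⟨ cong tm shift′ ⟨
    tm (1 + 2 * c + (1 + 2 * a))  ≡⟨ period (1 + 2 * a) 1+2a<i (≤-trans i≤ (+-monoʳ-≤ (1 + 2 * c) (n≤1+n _))) ⟨
    tm (1 + 2 * a)                ∎)
  where
  open ≡-Reasoning
  shift : 1 + 2 * c + 2 * a ≡ 1 + 2 * (a + c)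
  shift = solve (a ∷ c ∷ [])
  shift′ : 1 + 2 * c + (1 + 2 * a) ≡ 2 + 2 * (a + c)
  shift′ = solve (a ∷ c ∷ [])

-- Two adjacent pairs in the window yield three equal consecutive letters.
¬oddLocalPeriod-atOdd : ∀ k c → ¬ LocalPeriod tm (1 + 2 * suc k) (1 + 2 * c)
¬oddLocalPeriod-atOdd k zero = ¬localPeriod1-atOdd (suc k)
¬oddLocalPeriod-atOdd zero (suc c) period
  with oddLocalPeriod-oddPair (suc c) 0 period ≤-refl (m+k≡n⇒m≤n (1 + 2 * c) (solve (c ∷ [])))
... | ()
¬oddLocalPeriod-atOdd (suc k) (suc zero) period =
  tm[n]≡tm[1+n]⇒tm[1+n]≢tm[2+n] (suc k)
    (oddLocalPeriod-oddPair 1 (suc k) period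
      (m+k≡n⇒m≤n 0 (solve (k ∷ []))) (m+k≡n⇒m≤n 1 (solve (k ∷ []))))
    (subst (λ n → tm n ≡ tm (1 + n)) (+-comm (suc k) 1)
      (oddLocalPeriod-evenPair 1 (suc k) period
        (m+k≡n⇒m≤n 1 (solve (k ∷ []))) (m+k≡n⇒m≤n 0 (solve (k ∷ [])))))
¬oddLocalPeriod-atOdd (suc k) (suc (suc c)) period =
  tm[n]≡tm[1+n]⇒tm[1+n]≢tm[2+n] k
    (oddLocalPeriod-oddPair (2 + c) k period
      (m+k≡n⇒m≤n 2 (solve (k ∷ []))) (m+k≡n⇒m≤n (1 + 2 * c) (solve (k ∷ c ∷ []))))
    (oddLocalPeriod-oddPair (2 + c) (suc k) period
      (m+k≡n⇒m≤n 0 (solve (k ∷ []))) (m+k≡n⇒m≤n (3 + 2 * c) (solve (k ∷ c ∷ []))))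

3≤localPeriod-atOdd : ∀ k p → 0 < p → LocalPeriod tm (1 + 2 * k) p → 3 ≤ p
3≤localPeriod-atOdd k 1 _ period = contradiction period (¬localPeriod1-atOdd k)
3≤localPeriod-atOdd k 2 _ period with localPeriod-halve k 1 period
... | b , _ , period′ = contradiction period′ (¬localPeriod1-atOdd b)
3≤localPeriod-atOdd k (suc (suc (suc _))) _ _ = s≤s (s≤s (s≤s z≤n))

2*m≤1+2*n⇒m≤n : ∀ {m n} → 2 * m ≤ 1 + 2 * n → m ≤ n
2*m≤1+2*n⇒m≤n {m} {n} le = subst₂ _≤_ ([2n]/2≡n m) ([1+2n]/2≡n n) (/-monoˡ-≤ 2 le)

localPeriod-lowerBound : ∀ e k p → 2 ^ e ≤ 1 + 2 * k → 0 < p → LocalPeriod tm (1 + 2 * k) p →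
                         3 * 2 ^ e ≤ p
localPeriod-lowerBound zero    k       p _     0<p period = 3≤localPeriod-atOdd k p 0<p period
localPeriod-lowerBound (suc e) zero    p 2^e≤1 _   _      =
  contradiction (2*m≤1+2*n⇒m≤n 2^e≤1) (<⇒≱ (m^n>0 2 e))
localPeriod-lowerBound (suc e) (suc k) p 2^e≤I 0<p period with parity p
... | odd c        = contradiction period (¬oddLocalPeriod-atOdd k c)
... | even zero    = contradiction 0<p (λ ())
... | even (suc q) with localPeriod-halve (suc k) (suc q) period
...   | b , 1+k≤1+2b , period′ =
  subst (_≤ 2 * suc q) (x∙yz≈y∙xz 2 3 (2 ^ e))
    (*-monoʳ-≤ 2 (localPeriod-lowerBound e b (suc q) 2^e≤1+2b z<s period′))
  where
  2^e≤1+2b : 2 ^ e ≤ 1 + 2 * b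
  2^e≤1+2b = ≤-trans (2*m≤1+2*n⇒m≤n 2^e≤I) 1+k≤1+2b

localPeriod-3*2^e : ∀ e {i} → i ≤ 2 * 2 ^ e → LocalPeriod tm i (3 * 2 ^ e)
localPeriod-3*2^e e i≤2P j j<i _ = tm-period e (<-≤-trans j<i i≤2P)

periodicity-at-2+2k : ∀ k → Dec (tm (1 + 2 * k) ≡ tm (2 + 2 * k)) →
                      PeriodicityIs tm (2 + 2 * k) 1 ⊎ PeriodicityIs tm (2 + 2 * k) 2
periodicity-at-2+2k k (yes eq) = inj₁ (periodicityIs-1 tm (window⇒localPeriod tm 1 (1 + 2 * k) λ { z<s → eq }))
periodicity-at-2+2k k (no neq) = inj₂ (periodicityIs tm z<s (window⇒localPeriod tm 2 (2 * k) agree) noShorter)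
  where
  agree : ∀ {x} → x < 2 → tm (x + 2 * k) ≡ tm (2 + (x + 2 * k))
  agree z<s       = bit-≢-≢ (tm<2 (1 + 2 * k)) (tm<2 (2 * k)) (tm<2 (2 + 2 * k))
                      (tm[2n]≢tm[1+2n] k ∘ sym) neq
  agree (s<s z<s) = bit-≢-≢ (tm<2 (2 + 2 * k)) (tm<2 (1 + 2 * k)) (tm<2 (3 + 2 * k))
                      (neq ∘ sym) (subst (λ n → tm n ≢ tm (1 + n)) (*-suc 2 k) (tm[2n]≢tm[1+2n] (suc k)))
  noShorter : ∀ m → 0 < m → m < 2 → ¬ LocalPeriod tm (2 + 2 * k) m
  noShorter 1             _ _              period = neq (period (1 + 2 * k) ≤-refl ≤-refl)
  noShorter (suc (suc _)) _ (s<s (s<s ()))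

periodicity-at-even : ∀ k → PeriodicityIs tm (2 * k) 1 ⊎ PeriodicityIs tm (2 * k) 2
periodicity-at-even zero    = inj₁ (periodicityIs-1 tm λ _ ())
periodicity-at-even (suc k) = subst (λ i → PeriodicityIs tm i 1 ⊎ PeriodicityIs tm i 2) (sym (*-suc 2 k))
  (periodicity-at-2+2k k (tm (1 + 2 * k) ≟ tm (2 + 2 * k)))

periodicity-at-odd : ∀ k e → 2 ^ e ≤ 2 * k + 1 → 2 * k + 1 < 2 ^ (e + 1) →
                     PeriodicityIs tm (2 * k + 1) (3 * 2 ^ e)
periodicity-at-odd k e rewrite +-comm (2 * k) 1 | +-comm e 1 = λ lower upper →
  periodicityIs tm (≤-trans (m^n>0 2 e) (m≤m+n (2 ^ e) _)) (localPeriod-3*2^e e (<⇒≤ upper))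
    λ m 0<m m<3*2^e period → <⇒≱ m<3*2^e (localPeriod-lowerBound e k m lower 0<m period)

proposition1 : (∀ i → PeriodicityIs thueMorse (2 * i) 1 ⊎ PeriodicityIs thueMorse (2 * i) 2)
               × (∀ i t → 2 ^ t ≤ 2 * i + 1 → 2 * i + 1 < 2 ^ (t + 1)
                    → PeriodicityIs thueMorse (2 * i + 1) (3 * 2 ^ t))
proposition1 = periodicity-at-even , periodicity-at-odd
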